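{- Let $m>0$ be an integer and let $(x,y,z)$ be a Markoff $m$-triple whose entries are all Fibonacci numbers and which is not minimal. Then $m=2$ and $(x,y,z)=(1,F(b),F(b+2))$ for some even integer $b>2$.
   Context: $F(n)$ denotes the $n$-th Fibonacci number, $F(0)=0$, $F(1)=1$, $F(n+1)=F(n)+F(n-1)$. A Markoff $m$-triple is a triple $(x,y,z)$ of positive integers with $x\le y\le z$ satisfying $x^2+y^2+z^2=3xyz+m$; it is minimal if $z\ge 3xy$. -}

module Defs where

open import Data.Nat using (ℕ; zero; suc; _+_; _*_; _≤_; _<_)
open import Data.Product using (_×_; ∃-syntax)
open import Relation.Binary.PropositionalEquality using (_≡_)

F : ℕ → ℕ
F zero = 0
F (suc zero) = 1
F (suc (suc n)) = F (suc n) + F n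

IsFib : ℕ → Set
IsFib n = ∃[ i ] F i ≡ n

MarkoffTriple : ℕ → ℕ → ℕ → ℕ → Set
MarkoffTriple m x y z =
  (0 < x) × (x ≤ y) × (y ≤ z) × (x * x + y * y + z * z ≡ 3 * x * y * z + m)

Minimal : ℕ → ℕ → ℕ → Set
Minimal x y z = 3 * x * y ≤ z

-- For x ≥ 2 let z′ = 3xy − z be the Vieta partner of z, so that zz′ = x² + y² − m < 2y². If
-- 2z + y ≤ 6xy then y ≤ 2z′, whence z < 4y; but z′ < 2y, whence z = 3xy − z′ > 4y. So every
-- Markoff m-triple with m > 0 and x ≥ 2 has 2z + y > 6xy. For x = F a, y = F b the addition
-- formula gives 3xy ≤ F(a+b+1) and 2F(a+b) + y ≤ 6xy, so a Fibonacci z < 3xy would be at most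
-- F(a+b), contradicting 2z + y > 6xy: such triples are minimal.
-- For x = 1 the equation forces z > 2y, so a non-minimal Fibonacci triple has z = F(b+2). The
-- equation then reads 1 + F(b+1)² = F(b)² + F(b)F(b+1) + m, and Cassini's identity leaves only
-- m = 2 with b even.
module Submission where

open import Defs
open import Data.Nat using (ℕ; zero; suc; _+_; _*_; _≤_; _<_; _≤?_; z≤n; s≤s)
open import Data.Nat.Properties
open import Data.Nat.Tactic.RingSolver using (solve-∀; solve)
open import Data.List using ([]; _∷_)
open import Data.Product using (_×_; _,_; ∃-syntax)
open import Data.Sum using (_⊎_; inj₁; inj₂)
open import Relation.Binary using (tri<; tri≈; tri>)
open import Relation.Binary.PropositionalEquality
  using (_≡_; refl; sym; trans; cong; cong₂; subst; module ≡-Reasoning)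
open import Relation.Nullary using (¬_; yes; no; contradiction)

F-≤-suc : ∀ n → F n ≤ F (suc n)
F-≤-suc zero    = z≤n
F-≤-suc (suc n) = m≤m+n (F (suc n)) (F n)

F-mono-≤ : ∀ {m n} → m ≤ n → F m ≤ F n
F-mono-≤ {n = zero}  z≤n = ≤-refl
F-mono-≤ {n = suc n} m≤1+n with m≤n⇒m<n∨m≡n m≤1+n
... | inj₁ (s≤s m≤n) = ≤-trans (F-mono-≤ m≤n) (F-≤-suc n)
... | inj₂ refl      = ≤-refl

F-cancel-< : ∀ m n → F m < F n → m < n
F-cancel-< m n Fm<Fn with n ≤? m
... | yes n≤m = contradiction (F-mono-≤ n≤m) (<⇒≱ Fm<Fn)
... | no  n≰m = ≰⇒> n≰m

F-pos : ∀ n → 1 ≤ F (suc n)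
F-pos n = F-mono-≤ {1} {suc n} (s≤s z≤n)

F<F-suc : ∀ {n} → 2 ≤ n → F n < F (suc n)
F<F-suc {suc (suc n)} (s≤s (s≤s _)) = m<m+n (F (suc (suc n))) (F-pos n)

F-suc≤2*F : ∀ {n} → 1 ≤ n → F (suc n) ≤ 2 * F n
F-suc≤2*F {suc n} _ = +-monoʳ-≤ (F (suc n)) (≤-trans (F-≤-suc n) (m≤m+n (F (suc n)) 0))

3*F≤F[3+n] : ∀ n → 3 * F n ≤ F (3 + n)
3*F≤F[3+n] n = ≤-trans (≤-reflexive (triple (F n)))
  (+-mono-≤ (+-monoˡ-≤ (F n) (F-≤-suc n)) (F-≤-suc n))
  where
  triple : ∀ a → 3 * a ≡ a + a + a
  triple = solve-∀

F-add : ∀ m n → F (suc (m + n)) ≡ F (suc m) * F (suc n) + F m * F n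
F-add zero          n = sym (trans (+-identityʳ (1 * F (suc n))) (*-identityˡ (F (suc n))))
F-add (suc zero)    n = sym (cong₂ _+_ (*-identityˡ (F (suc n))) (*-identityˡ (F n)))
F-add (suc (suc m)) n =
  trans (cong₂ _+_ (F-add (suc m) n) (F-add m n)) (regroup (F (suc m)) (F m) (F (suc n)) (F n))
  where
  regroup : ∀ a b p q → (a + b) * p + a * q + (a * p + b * q) ≡ (a + b + a) * p + (a + b) * q
  regroup = solve-∀

3*Fa*Fb≤F[1+a+b] : ∀ {a b} → 2 ≤ a → 2 ≤ b → 3 * F a * F b ≤ F (suc (a + b))
3*Fa*Fb≤F[1+a+b] {a@(suc (suc i))} {b@(suc (suc j))} (s≤s (s≤s _)) (s≤s (s≤s _)) = begin
  3 * F a * F b                       ≤⟨ slack (F (suc i)) (F i) (F (suc j)) (F j) (F-≤-suc i) (F-≤-suc j) ⟩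
  F (suc a) * F (suc b) + F a * F b   ≡⟨ F-add a b ⟨
  F (suc (a + b))                     ∎
  where
  open ≤-Reasoning
  slack : ∀ p q r s → q ≤ p → s ≤ r →
    3 * (p + q) * (r + s) ≤ (p + q + p) * (r + s + r) + (p + q) * (r + s)
  slack p q r s q≤p s≤r = +-cancelʳ-≤ (q * s) _ _ (begin
    3 * (p + q) * (r + s) + q * s
      ≤⟨ +-monoʳ-≤ _ (≤-trans (*-mono-≤ q≤p s≤r) (m≤m+n (p * r) (p * r))) ⟩
    3 * (p + q) * (r + s) + (p * r + p * r)
      ≡⟨ solve (p ∷ q ∷ r ∷ s ∷ []) ⟩
    (p + q + p) * (r + s + r) + (p + q) * (r + s) + q * s ∎)

2*F[a+b]+Fb≤6*Fa*Fb : ∀ {a b} → 3 ≤ a → 1 ≤ b → 2 * F (a + b) + F b ≤ 6 * F a * F b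
2*F[a+b]+Fb≤6*Fa*Fb {suc a} {b} (s≤s 2≤a) 1≤b = begin
  2 * F (suc a + b) + F b                          ≡⟨ cong (λ t → 2 * t + F b) (F-add a b) ⟩
  2 * (F (suc a) * F (suc b) + F a * F b) + F b   ≤⟨ bound (F-suc≤2*F 1≤b) (F<F-suc 2≤a) ⟩
  6 * F (suc a) * F b                              ∎
  where
  open ≤-Reasoning
  bound : ∀ {A A′ B B₁} → B₁ ≤ 2 * B → A′ < A → 2 * (A * B₁ + A′ * B) + B ≤ 6 * A * B
  bound {A} {A′} {B} {B₁} B₁≤2B A′<A = begin
    2 * (A * B₁ + A′ * B) + B          ≤⟨ +-monoʳ-≤ _ (m≤n+m B B) ⟩
    2 * (A * B₁ + A′ * B) + (B + B)    ≡⟨ solve (A ∷ A′ ∷ B ∷ B₁ ∷ []) ⟩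
    2 * (A * B₁ + (1 + A′) * B)        ≤⟨ *-monoʳ-≤ 2 (+-mono-≤ (*-monoʳ-≤ A B₁≤2B) (*-monoˡ-≤ B A′<A)) ⟩
    2 * (A * (2 * B) + A * B)          ≡⟨ solve (A ∷ B ∷ []) ⟩
    6 * A * B                          ∎

markoff-vieta : ∀ {m x y z z′} → z + z′ ≡ 3 * x * y →
  x * x + y * y + z * z ≡ 3 * x * y * z + m → x * x + y * y ≡ z * z′ + m
markoff-vieta {m} {x} {y} {z} {z′} z+z′≡3xy eq = +-cancelʳ-≡ (z * z) _ _ (begin
  x * x + y * y + z * z   ≡⟨ eq ⟩
  3 * x * y * z + m       ≡⟨ cong (λ s → s * z + m) z+z′≡3xy ⟨
  (z + z′) * z + m        ≡⟨ solve (m ∷ z ∷ z′ ∷ []) ⟩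
  z * z′ + m + z * z      ∎)
  where open ≡-Reasoning

markoff-2z′<y : ∀ {m x y z z′} → 0 < m → 2 ≤ x → x ≤ y → y ≤ z → z + z′ ≡ 3 * x * y →
  x * x + y * y ≡ z * z′ + m → 2 * z′ < y
markoff-2z′<y {m} {x} {y} {z} {z′} 0<m 2≤x x≤y y≤z z+z′≡3xy xx+yy≡zz′+m = ≰⇒> λ y≤2z′ →
  <-asym (4y<z z′<2y) (z<4y y≤2z′)
  where
  open ≤-Reasoning
  zz′<2yy : z * z′ < 2 * y * y
  zz′<2yy = begin-strict
    z * z′         <⟨ m<m+n (z * z′) 0<m ⟩
    z * z′ + m     ≡⟨ xx+yy≡zz′+m ⟨
    x * x + y * y  ≤⟨ +-monoˡ-≤ (y * y) (*-mono-≤ x≤y x≤y) ⟩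
    y * y + y * y  ≡⟨ solve (y ∷ []) ⟩
    2 * y * y      ∎
  z′<2y : z′ < 2 * y
  z′<2y = *-cancelʳ-< y z′ (2 * y) (begin-strict
    z′ * y     ≤⟨ *-monoʳ-≤ z′ y≤z ⟩
    z′ * z     ≡⟨ *-comm z′ z ⟩
    z * z′     <⟨ zz′<2yy ⟩
    2 * y * y  ∎)
  z<4y : y ≤ 2 * z′ → z < 4 * y
  z<4y y≤2z′ = *-cancelʳ-< y z (4 * y) (begin-strict
    z * y              ≤⟨ *-monoʳ-≤ z y≤2z′ ⟩
    z * (2 * z′)       ≡⟨ solve (z ∷ z′ ∷ []) ⟩
    2 * (z * z′)       <⟨ *-monoʳ-< 2 zz′<2yy ⟩
    2 * (2 * y * y)    ≡⟨ solve (y ∷ []) ⟩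
    4 * y * y          ∎)
  4y<z : z′ < 2 * y → 4 * y < z
  4y<z z′<2y = +-cancelʳ-< (2 * y) (4 * y) z (begin-strict
    4 * y + 2 * y      ≡⟨ solve (y ∷ []) ⟩
    3 * 2 * y          ≤⟨ *-monoˡ-≤ y (*-monoʳ-≤ 3 2≤x) ⟩
    3 * x * y          ≡⟨ z+z′≡3xy ⟨
    z + z′             <⟨ +-monoʳ-< z z′<2y ⟩
    z + 2 * y          ∎)

markoff-6xy<2z+y : ∀ {m x y z} → 0 < m → 2 ≤ x → MarkoffTriple m x y z → 6 * x * y < 2 * z + y
markoff-6xy<2z+y {m} {x} {y} {z} 0<m 2≤x (_ , x≤y , y≤z , eq) with z ≤? 3 * x * y
... | no z≰3xy = begin-strict
  6 * x * y        ≡⟨ solve (x ∷ y ∷ []) ⟩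
  2 * (3 * x * y)  <⟨ *-monoʳ-< 2 (≰⇒> z≰3xy) ⟩
  2 * z            ≤⟨ m≤m+n (2 * z) y ⟩
  2 * z + y        ∎
  where open ≤-Reasoning
... | yes z≤3xy with z′ , z+z′≡3xy ← m≤n⇒∃[o]m+o≡n z≤3xy = begin-strict
  6 * x * y        ≡⟨ solve (x ∷ y ∷ []) ⟩
  2 * (3 * x * y)  ≡⟨ cong (2 *_) z+z′≡3xy ⟨
  2 * (z + z′)     ≡⟨ *-distribˡ-+ 2 z z′ ⟩
  2 * z + 2 * z′   <⟨ +-monoʳ-< (2 * z) (markoff-2z′<y 0<m 2≤x x≤y y≤z z+z′≡3xy (markoff-vieta {m} {x} {y} z+z′≡3xy eq)) ⟩
  2 * z + y        ∎
  where open ≤-Reasoning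

markoff-1-difference : ∀ {m z} y w → y + w ≡ z →
  1 * 1 + y * y + z * z ≡ 3 * 1 * y * z + m → 1 + w * w ≡ y * y + y * w + m
markoff-1-difference {m} y w refl eq = +-cancelʳ-≡ (y * y + y * y + y * w + y * w) _ _ (begin
  1 + w * w + (y * y + y * y + y * w + y * w)  ≡⟨ solve (y ∷ w ∷ []) ⟩
  1 * 1 + y * y + (y + w) * (y + w)            ≡⟨ eq ⟩
  3 * 1 * y * (y + w) + m                      ≡⟨ solve (m ∷ y ∷ w ∷ []) ⟩
  y * y + y * w + m + (y * y + y * y + y * w + y * w) ∎)
  where open ≡-Reasoning

markoff-2y<z : ∀ {m y z} → 0 < m → MarkoffTriple m 1 y z → 2 * y < z
markoff-2y<z {m} {y} {z} 0<m (_ , 1≤y , y≤z , eq) with w , y+w≡z ← m≤n⇒∃[o]m+o≡n y≤z =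
  ≰⇒> λ z≤2y → <-irrefl (markoff-1-difference y w y+w≡z eq)
    (≤-<-trans (+-mono-≤ (*-mono-≤ 1≤y 1≤y) (*-monoˡ-≤ w (w≤y z≤2y))) (m<m+n (y * y + y * w) 0<m))
  where
  w≤y : z ≤ 2 * y → w ≤ y
  w≤y z≤2y = +-cancelˡ-≤ y w y (begin
    y + w   ≡⟨ y+w≡z ⟩
    z       ≤⟨ z≤2y ⟩
    2 * y   ≡⟨ solve (y ∷ []) ⟩
    y + y   ∎)
    where open ≤-Reasoning

even-or-odd : ∀ n → ∃[ k ] (n ≡ 2 * k ⊎ n ≡ 1 + 2 * k)
even-or-odd zero = 0 , inj₁ refl
even-or-odd (suc n) with even-or-odd n
... | k , inj₁ refl = k , inj₂ refl
... | k , inj₂ refl = suc k , inj₁ (sym (*-suc 2 k))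

-- Cassini's identity F(n+1)² − F(n)F(n+1) − F(n)² = (−1)ⁿ, one subtraction-free equation per sign.
CassiniEven CassiniOdd : ℕ → Set
CassiniEven n = F (1 + n) * F (1 + n) ≡ F n * F n + F n * F (1 + n) + 1
CassiniOdd  n = F n * F n + F n * F (1 + n) ≡ F (1 + n) * F (1 + n) + 1

CassiniEven⇒CassiniOdd-suc : ∀ n → CassiniEven n → CassiniOdd (1 + n)
CassiniEven⇒CassiniOdd-suc n = step (F n) (F (1 + n))
  where
  open ≡-Reasoning
  step : ∀ u v → v * v ≡ u * u + u * v + 1 → v * v + v * (v + u) ≡ (v + u) * (v + u) + 1
  step u v h = begin
    v * v + v * (v + u)                  ≡⟨ solve (u ∷ v ∷ []) ⟩
    v * v + (v * v + u * v)              ≡⟨ cong (_+ (v * v + u * v)) h ⟩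
    u * u + u * v + 1 + (v * v + u * v)  ≡⟨ solve (u ∷ v ∷ []) ⟩
    (v + u) * (v + u) + 1                ∎

CassiniOdd⇒CassiniEven-suc : ∀ n → CassiniOdd n → CassiniEven (1 + n)
CassiniOdd⇒CassiniEven-suc n = step (F n) (F (1 + n))
  where
  open ≡-Reasoning
  step : ∀ p q → p * p + p * q ≡ q * q + 1 → (q + p) * (q + p) ≡ q * q + q * (q + p) + 1
  step p q h = begin
    (q + p) * (q + p)               ≡⟨ solve (p ∷ q ∷ []) ⟩
    q * q + p * q + (p * p + p * q) ≡⟨ cong (q * q + p * q +_) h ⟩
    q * q + p * q + (q * q + 1)     ≡⟨ solve (p ∷ q ∷ []) ⟩
    q * q + q * (q + p) + 1         ∎

cassini-even : ∀ k → CassiniEven (2 * k)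
cassini-odd  : ∀ k → CassiniOdd (1 + 2 * k)

cassini-even zero    = refl
cassini-even (suc k) = subst CassiniEven (sym (*-suc 2 k)) (CassiniOdd⇒CassiniEven-suc (1 + 2 * k) (cassini-odd k))
cassini-odd k        = CassiniEven⇒CassiniOdd-suc (2 * k) (cassini-even k)

cassini-m≡2 : ∀ {m} n → 0 < m →
  1 + F (1 + n) * F (1 + n) ≡ F n * F n + F n * F (1 + n) + m → m ≡ 2 × ∃[ k ] n ≡ 2 * k
cassini-m≡2 n 0<m eq with even-or-odd n
... | k , inj₁ refl = m≡2 (cassini-even k) eq , k , refl
  where
  open ≡-Reasoning
  m≡2 : ∀ {X V m} → V ≡ X + 1 → 1 + V ≡ X + m → m ≡ 2
  m≡2 {X} {V} {m} V≡X+1 eq = +-cancelˡ-≡ X m 2 (begin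
    X + m        ≡⟨ eq ⟨
    1 + V        ≡⟨ cong (1 +_) V≡X+1 ⟩
    1 + (X + 1)  ≡⟨ solve (X ∷ []) ⟩
    X + 2        ∎)
... | k , inj₂ refl = contradiction (m≡0 (cassini-odd k) eq) (>⇒≢ 0<m)
  where
  open ≡-Reasoning
  m≡0 : ∀ {X V m} → X ≡ V + 1 → 1 + V ≡ X + m → m ≡ 0
  m≡0 {X} {V} {m} X≡V+1 eq = +-cancelˡ-≡ (V + 1) m 0 (begin
    V + 1 + m    ≡⟨ cong (_+ m) X≡V+1 ⟨
    X + m        ≡⟨ eq ⟨
    1 + V        ≡⟨ solve (V ∷ []) ⟩
    V + 1 + 0    ∎)

Exceptional : ℕ → ℕ → ℕ → ℕ → Set
Exceptional m x y z = m ≡ 2 × ∃[ k ] (2 < 2 * k × x ≡ 1 × y ≡ F (2 * k) × z ≡ F (2 * k + 2))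

fib-triple-minimal : ∀ {m a b c} → 0 < m → 3 ≤ a →
  MarkoffTriple m (F a) (F b) (F c) → Minimal (F a) (F b) (F c)
fib-triple-minimal {m} {a} {b} {c} 0<m 3≤a t@(_ , x≤y , _) = ≮⇒≥ λ z<3xy →
  <⇒≱ (markoff-6xy<2z+y 0<m 2≤x t) (begin
    2 * F c + F b        ≤⟨ +-monoˡ-≤ (F b) (*-monoʳ-≤ 2 (z≤F[a+b] z<3xy)) ⟩
    2 * F (a + b) + F b  ≤⟨ 2*F[a+b]+Fb≤6*Fa*Fb 3≤a (<⇒≤ 2≤b) ⟩
    6 * F a * F b        ∎)
  where
  open ≤-Reasoning
  2≤x : 2 ≤ F a
  2≤x = F-mono-≤ {3} 3≤a
  2≤b : 2 ≤ b
  2≤b = F-cancel-< 1 b (≤-trans 2≤x x≤y)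
  z≤F[a+b] : F c < 3 * F a * F b → F c ≤ F (a + b)
  z≤F[a+b] z<3xy = F-mono-≤ (≤-pred (F-cancel-< c (suc (a + b))
    (<-≤-trans z<3xy (3*Fa*Fb≤F[1+a+b] (<⇒≤ 3≤a) 2≤b))))

fib-triple-1-exceptional : ∀ {m b c} → 0 < m →
  MarkoffTriple m 1 (F b) (F c) → ¬ Minimal 1 (F b) (F c) → Exceptional m 1 (F b) (F c)
fib-triple-1-exceptional {m} {b} {c} 0<m t@(_ , 1≤y , _ , eq) nonmin with <-cmp c (2 + b)
... | tri< c<2+b _ _ = contradiction (markoff-2y<z 0<m t) (≤⇒≯ (begin
  F c        ≤⟨ F-mono-≤ (≤-pred c<2+b) ⟩
  F (1 + b)  ≤⟨ F-suc≤2*F (F-cancel-< 0 b 1≤y) ⟩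
  2 * F b    ∎))
  where open ≤-Reasoning
... | tri> _ _ 2+b<c = contradiction (≤-trans (3*F≤F[3+n] b) (F-mono-≤ 2+b<c)) nonmin
... | tri≈ _ refl _ with cassini-m≡2 b 0<m (markoff-1-difference (F b) (F (1 + b)) (+-comm (F b) (F (1 + b))) eq)
...   | m≡2 , zero , refl = contradiction 1≤y λ ()
...   | m≡2 , 1 , refl = contradiction ≤-refl nonmin  -- b = 2 gives the minimal triple (1, 1, 3)
...   | m≡2 , k@(suc (suc k′)) , refl =
  m≡2 , k , ≤-trans (n≤1+n 3) (*-monoʳ-≤ 2 (m≤m+n 2 k′)) , refl , refl , cong F (+-comm 2 (2 * k))

proposition4p2 : (m x y z : ℕ) → 0 < m → MarkoffTriple m x y z →
    IsFib x → IsFib y → IsFib z → ¬ Minimal x y z →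
    m ≡ 2 × (∃[ k ] (2 < 2 * k × x ≡ 1 × y ≡ F (2 * k) × z ≡ F (2 * k + 2)))
proposition4p2 m _ _ _ 0<m (() , _) (zero , refl) _ _ _
proposition4p2 m _ _ _ 0<m t (1 , refl) (b , refl) (c , refl) nonmin =
  fib-triple-1-exceptional {m} {b} {c} 0<m t nonmin
proposition4p2 m _ _ _ 0<m t (2 , refl) (b , refl) (c , refl) nonmin =
  fib-triple-1-exceptional {m} {b} {c} 0<m t nonmin
proposition4p2 m _ _ _ 0<m t (suc (suc (suc i)) , refl) (b , refl) (c , refl) nonmin =
  contradiction (fib-triple-minimal {m} {3 + i} {b} {c} 0<m (s≤s (s≤s (s≤s z≤n))) t) nonmin
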